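{- Let $k\ge 4$ be an integer. For $t\in\mathbb{Z}^+$ let $\mathcal{G}_{k,t}$ be the family of all connected graphs $G$ with minimum degree at least $k$ and girth at least $2t+1$. Then $$\lim_{t\to\infty}\ \sup_{G\in\mathcal{G}_{k,t}}\frac{\pi^*(G)}{|V(G)|}=0.$$
   Context: All graphs are finite and simple. A pebbling distribution $D$ on a graph $G$ is a function $D:V(G)\to\mathbb{Z}_{\ge 0}$; its size is $|D|=\sum_v D(v)$. A pebbling move removes two pebbles from a vertex having at least two pebbles and places one pebble on an adjacent vertex. A vertex $v$ is reachable under $D$ if some sequence of legal pebbling moves puts at least one pebble on $v$. $D$ is solvable if every vertex is reachable. The optimal pebbling number $\pi^*(G)$ is the minimum size of a solvable distribution on $G$. The girth is the length of a shortest cycle (infinite for acyclic graphs). -}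

module Defs where

open import Data.Nat using (ℕ; zero; suc; _+_; _*_; _∸_; _≤_; _<_)
open import Data.Fin using (Fin; zero; suc; inject₁; fromℕ; _≟_)
open import Data.List using (List; length; filter; map; allFin)
open import Data.Nat.ListAction using (sum)
open import Data.Product using (Σ; ∃; ∃-syntax; _×_; _,_)
open import Relation.Nullary using (¬_; Dec; yes; no)
open import Relation.Unary using (Decidable)
open import Relation.Binary.PropositionalEquality using (_≡_)
open import Relation.Binary.Construct.Closure.ReflexiveTransitive using (Star)
open import Function.Definitions using (Injective)

record Graph (n : ℕ) : Set₁ where
  field
    Adj   : Fin n → Fin n → Set
    adj?  : ∀ u → Decidable (Adj u)
    sym   : ∀ {u v} → Adj u v → Adj v u
    irrefl : ∀ {u} → ¬ Adj u u
open Graph public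

degree : ∀ {n} → Graph n → Fin n → ℕ
degree {n} G v = length (filter (adj? G v) (allFin n))

MinDegreeAtLeast : ∀ {n} → Graph n → ℕ → Set
MinDegreeAtLeast G k = ∀ v → k ≤ degree G v

Connected : ∀ {n} → Graph n → Set
Connected {n} G = ∀ (u v : Fin n) → Star (Adj G) u v

-- a cycle of length (suc m): distinct vertices f 0, ..., f m with consecutive
-- ones adjacent and f m adjacent to f 0
IsCycle : ∀ {n} → Graph n → (m : ℕ) → (Fin (suc m) → Fin n) → Set
IsCycle G m f =
  Injective _≡_ _≡_ f ×
  (∀ (i : Fin m) → Adj G (f (inject₁ i)) (f (suc i))) ×
  Adj G (f (fromℕ m)) (f zero)

GirthAtLeast : ∀ {n} → Graph n → ℕ → Set
GirthAtLeast {n} G g =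
  ∀ (m : ℕ) → 3 ≤ suc m → suc m < g → ¬ (Σ (Fin (suc m) → Fin n) (IsCycle G m))

Distribution : ℕ → Set
Distribution n = Fin n → ℕ

size : ∀ {n} → Distribution n → ℕ
size {n} D = sum (map D (allFin n))

moveResult : ∀ {n} → Distribution n → Fin n → Fin n → Distribution n
moveResult D u v w with w ≟ u | w ≟ v
... | yes _ | _     = D w ∸ 2
... | no _  | yes _ = suc (D w)
... | no _  | no _  = D w

data Move {n} (G : Graph n) (D : Distribution n) : Distribution n → Set where
  move : ∀ u v → Adj G u v → 2 ≤ D u → Move G D (moveResult D u v)

Reachable : ∀ {n} → Graph n → Distribution n → Fin n → Set
Reachable G D v = ∃[ D' ] (Star (Move G) D D' × 1 ≤ D' v)

Solvable : ∀ {n} → Graph n → Distribution n → Set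
Solvable G D = ∀ v → Reachable G D v

IsOptimalPebblingNumber : ∀ {n} → Graph n → ℕ → Set
IsOptimalPebblingNumber G m =
  (∃[ D ] (Solvable G D × size D ≡ m)) ×
  (∀ D → Solvable G D → m ≤ size D)

-- Put piles of 2^r pebbles on a set of "centres"; a pile reaches everything
-- within distance r. If the girth exceeds 2r, the non-backtracking walks of length r
-- from a vertex of degree ≥ 4 branch at least three ways at each step and end at
-- pairwise distinct vertices, so every ball of radius r has at least 3^r vertices.
-- A greedy covering argument then finds about 2nJ/3^r centres whose balls cover all
-- but n/2^J vertices; these leftovers get piles of their own. The total,
-- 2^r (2nJ/3^r + n/2^J), is below n/q once r and J = r + O(q) are chosen suitably,
-- because (3/2)^r eventually dominates r.
module Submission where

open import Defs hiding (sym)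
open import Data.Nat using (ℕ; zero; suc; _+_; _*_; _∸_; _^_; _≤_; _<_; _≤?_; z≤n; s≤s; >-nonZero)
open import Data.Nat.Properties
open import Data.Nat.Induction using (<-rec)
open import Data.Nat.ListAction using (sum)
open import Data.Nat.Tactic.RingSolver using (solve-∀)
open import Data.Bool using (Bool; true; false; _∧_; not)
open import Data.Fin using (Fin; zero; suc; toℕ; inject₁; inject≤; fromℕ)
import Data.Fin.Properties as Fin
open import Data.List using (List; []; _∷_; _++_; length; allFin; tabulate; lookup; filter)
open import Data.List.Properties using (map-tabulate; filter-all; length-++)
import Data.List.Relation.Unary.All as All
open import Data.List.Relation.Unary.Any using (here; there)
open import Data.List.Relation.Unary.AllPairs using (_∷_)
open import Data.List.Relation.Unary.Unique.Propositional using (Unique)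
import Data.List.Relation.Unary.Unique.Propositional.Properties as Unique
open import Data.List.Membership.Propositional using (_∈_)
open import Data.List.Membership.Propositional.Properties using (∈-lookup; ∈-filter⁻; ∈-++⁺ˡ; ∈-++⁺ʳ)
open import Data.Product using (∃-syntax; Σ; _×_; _,_; proj₁; proj₂)
open import Data.Sum using (_⊎_; inj₁; inj₂; [_,_]′)
open import Data.Empty using (⊥-elim)
open import Function using (_∘_; id; case_of_)
open import Relation.Nullary using (¬_; ¬?; Dec; yes; no)
open import Relation.Nullary.Decidable using (does; _⊎-dec_; _×-dec_)
open import Relation.Binary using (tri<; tri≈; tri>)
open import Relation.Binary.PropositionalEquality
open import Relation.Binary.Construct.Closure.ReflexiveTransitive using (Star; ε; _◅_; _◅◅_)
open import Algebra.Properties.Semiring.Sum +-*-semiring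
  using (∑-distrib-+; ∑-comm; *-distribˡ-sum; sum-cong-≗) renaming (sum to ∑)

-- The indicator of a boolean. Sets of vertices are boolean functions W, and
-- ∑ (𝟙 ∘ W) is the number of elements of W.
𝟙 : Bool → ℕ
𝟙 true  = 1
𝟙 false = 0

∑-mono : ∀ {n} {f g : Fin n → ℕ} → (∀ i → f i ≤ g i) → ∑ f ≤ ∑ g
∑-mono {zero}  f≤g = z≤n
∑-mono {suc n} f≤g = +-mono-≤ (f≤g zero) (∑-mono (f≤g ∘ suc))

∑-zero : ∀ n → ∑ {n} (λ _ → 0) ≡ 0
∑-zero zero    = refl
∑-zero (suc n) = ∑-zero n

∑-point : ∀ {n} (x : Fin n) → ∑ (λ z → 𝟙 (does (z Fin.≟ x))) ≡ 1
∑-point {suc n} zero    = cong suc (∑-zero n)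
∑-point {suc n} (suc x) = ∑-point x

∑-const : ∀ n c → ∑ {n} (λ _ → c) ≡ n * c
∑-const zero    c = refl
∑-const (suc n) c = cong (c +_) (∑-const n c)

evidence : ∀ {P : Set} (P? : Dec P) → does P? ≡ true → P
evidence (yes p) _ = p

𝟙-mono : ∀ {P Q : Set} (P? : Dec P) (Q? : Dec Q) → (P → Q) → 𝟙 (does P?) ≤ 𝟙 (does Q?)
𝟙-mono (yes p) (yes _) P⇒Q = ≤-refl
𝟙-mono (yes p) (no ¬q) P⇒Q = ⊥-elim (¬q (P⇒Q p))
𝟙-mono (no _)  Q?      P⇒Q = z≤n

𝟙-any : ∀ {b} {P : Fin b → Set} (P? : ∀ i → Dec (P i)) → (∀ {i j} → P i → P j → i ≡ j) →
        𝟙 (does (Fin.any? P?)) ≡ ∑ (λ i → 𝟙 (does (P? i)))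
𝟙-any {zero}  P? atMostOne = refl
𝟙-any {suc b} P? atMostOne with P? zero
... | yes P0 = cong suc (sym (trans (sum-cong-≗ none) (∑-zero b)))
  where
  none : ∀ i → 𝟙 (does (P? (suc i))) ≡ 0
  none i with P? (suc i)
  ... | yes Pi = case atMostOne P0 Pi of λ ()
  ... | no _   = refl
... | no _   = 𝟙-any (P? ∘ suc) (λ Pi Pj → Fin.suc-injective (atMostOne Pi Pj))

∣_∣ : ∀ {n} → (Fin n → Bool) → ℕ
∣ W ∣ = ∑ (𝟙 ∘ W)

∣∣≤ : ∀ {n} (W : Fin n → Bool) → ∣ W ∣ ≤ n
∣∣≤ {zero}  W = z≤n
∣∣≤ {suc n} W = +-mono-≤ (𝟙≤1 (W zero)) (∣∣≤ (W ∘ suc))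
  where
  𝟙≤1 : ∀ b → 𝟙 b ≤ 1
  𝟙≤1 true  = s≤s z≤n
  𝟙≤1 false = z≤n

∑-average : ∀ {n} (g : Fin n → ℕ) → ∑ g ≡ 0 ⊎ ∃[ w ] (∑ g ≤ n * g w)
∑-average {zero}  g = inj₁ refl
∑-average {suc n} g with ∑-average (g ∘ suc)
... | inj₁ rest≡0 = inj₂ (zero , +-monoʳ-≤ (g zero) (subst (_≤ n * g zero) (sym rest≡0) z≤n))
... | inj₂ (w , rest≤) with ≤-total (g (suc w)) (g zero)
...   | inj₁ gw≤g0 = inj₂ (zero , +-monoʳ-≤ (g zero) (≤-trans rest≤ (*-monoʳ-≤ n gw≤g0)))
...   | inj₂ g0≤gw = inj₂ (suc w , +-mono-≤ g0≤gw rest≤)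

positive-factor : ∀ m {k} → 1 ≤ m * k → 1 ≤ k
positive-factor m {zero}  1≤m*0 = ⊥-elim (1+n≰n (subst (1 ≤_) (*-zeroʳ m) 1≤m*0))
positive-factor m {suc k} _     = s≤s z≤n

size≡∑ : ∀ {n} (D : Distribution n) → size D ≡ ∑ D
size≡∑ {n} D = trans (cong sum (map-tabulate id D)) (sum-tabulate D)
  where
  sum-tabulate : ∀ {m} (f : Fin m → ℕ) → sum (tabulate f) ≡ ∑ f
  sum-tabulate {zero}  f = refl
  sum-tabulate {suc m} f = cong (f zero +_) (sum-tabulate (f ∘ suc))

moveResult-source : ∀ {n} (D : Distribution n) u v → moveResult D u v u ≡ D u ∸ 2
moveResult-source D u v with u Fin.≟ u
... | yes _   = refl
... | no u≢u = ⊥-elim (u≢u refl)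

moveResult-target : ∀ {n} (D : Distribution n) u v → u ≢ v → moveResult D u v v ≡ suc (D v)
moveResult-target D u v u≢v with v Fin.≟ u | v Fin.≟ v
... | yes v≡u | _       = ⊥-elim (u≢v (sym v≡u))
... | no _    | yes _   = refl
... | no _    | no v≢v = ⊥-elim (v≢v refl)

afford : ∀ {n} j (D : Distribution n) u v → 2 * suc j ≤ D u → 2 ≤ D u × 2 * j ≤ moveResult D u v u
afford j D u v enough = ≤-trans (m≤m+n 2 (2 * j)) 2+2j≤ ,
  subst (2 * j ≤_) (sym (moveResult-source D u v))
    (m+n≤o⇒m≤o∸n (2 * j) (subst (_≤ D u) (+-comm 2 (2 * j)) 2+2j≤))
  where
  2+2j≤ : 2 + 2 * j ≤ D u
  2+2j≤ = subst (_≤ D u) (*-suc 2 j) enough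

module Pebbling {n : ℕ} (G : Graph n) where

  Within : ℕ → Fin n → Fin n → Set
  Within zero    w x = w ≡ x
  Within (suc r) w x = w ≡ x ⊎ ∃[ y ] (Adj G w y × Within r y x)

  within? : ∀ r w x → Dec (Within r w x)
  within? zero    w x = w Fin.≟ x
  within? (suc r) w x = (w Fin.≟ x) ⊎-dec Fin.any? (λ y → adj? G w y ×-dec within? r y x)

  within-refl : ∀ r x → Within r x x
  within-refl zero    x = refl
  within-refl (suc r) x = inj₁ refl

  within-snoc : ∀ r {w y x} → Within r w y → Adj G y x → Within (suc r) w x
  within-snoc zero    refl                   y~x = inj₂ (_ , y~x , refl)
  within-snoc (suc r) (inj₁ refl)            y~x = inj₂ (_ , y~x , within-refl (suc r) _)
  within-snoc (suc r) (inj₂ (z , w~z , z→y)) y~x = inj₂ (z , w~z , within-snoc r z→y y~x)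

  within-sym : ∀ r {w x} → Within r w x → Within r x w
  within-sym zero    w≡x                    = sym w≡x
  within-sym (suc r) (inj₁ w≡x)             = inj₁ (sym w≡x)
  within-sym (suc r) (inj₂ (y , w~y , y→x)) = within-snoc r (within-sym r y→x) (Graph.sym G w~y)

  push : ∀ j (D : Distribution n) u v → Adj G u v → 2 * j ≤ D u →
         ∃[ D' ] (Star (Move G) D D' × D v + j ≤ D' v)
  push zero    D u v u~v _ = D , ε , ≤-reflexive (+-identityʳ (D v))
  push (suc j) D u v u~v enough with afford j D u v enough
  ... | two , rest with push j (moveResult D u v) u v u~v rest
  ...   | D' , moves , gain = D' , move u v u~v two ◅ moves , (begin
    D v + suc j                 ≡⟨ +-suc (D v) j ⟩
    suc (D v) + j               ≡⟨ cong (_+ j) (moveResult-target D u v (λ { refl → irrefl G u~v })) ⟨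
    moveResult D u v v + j      ≤⟨ gain ⟩
    D' v                        ∎)
    where open ≤-Reasoning

  pile-reaches : ∀ r w x (D : Distribution n) → Within r w x → 2 ^ r ≤ D w → Reachable G D x
  pile-reaches zero    w x D refl pile = D , ε , pile
  pile-reaches (suc r) w x D (inj₁ refl) pile = D , ε , ≤-trans (m^n>0 2 (suc r)) pile
  pile-reaches (suc r) w x D (inj₂ (y , w~y , y→x)) pile
    with push (2 ^ r) D w y w~y pile
  ... | D' , moves , gain with pile-reaches r y x D' y→x (≤-trans (m≤n+m (2 ^ r) (D y)) gain)
  ...   | D'' , moves' , reached = D'' , moves ◅◅ moves' , reached

∸-split : ∀ m k L → m + k ≤ L → L ∸ k ≡ m + (L ∸ (m + k))
∸-split m k L m+k≤L = begin
  L ∸ k              ≡⟨ m+[n∸m]≡n (m+n≤o⇒m≤o∸n m m+k≤L) ⟨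
  m + (L ∸ k ∸ m)    ≡⟨ cong (m +_) (∸-+-assoc L k m) ⟩
  m + (L ∸ (k + m))  ≡⟨ cong (λ s → m + (L ∸ s)) (+-comm k m) ⟩
  m + (L ∸ (m + k))  ∎
  where open ≡-Reasoning

module Cycles {n : ℕ} (G : Graph n) where

  record NonBacktracking (u : ℕ → Fin n) (L : ℕ) : Set where
    field
      step     : ∀ k → k < L → Adj G (u k) (u (suc k))
      noReturn : ∀ k → 2 + k ≤ L → u k ≢ u (2 + k)

  record ClosedWalk (u : ℕ → Fin n) (L : ℕ) : Set where
    field
      positive : 1 ≤ L
      walk     : NonBacktracking u L
      closed   : u L ≡ u 0

  CycleWithin : ℕ → Set
  CycleWithin L = ∃[ m ] (3 ≤ suc m × suc m ≤ L × Σ (Fin (suc m) → Fin n) (IsCycle G m))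

  nonBacktracking-shift : ∀ {u L} i M → NonBacktracking u L → i + M ≤ L →
                          NonBacktracking (λ k → u (i + k)) M
  nonBacktracking-shift {u} {L} i M nb i+M≤L = record { step = step' ; noReturn = noReturn' }
    where
    open NonBacktracking nb
    within : ∀ {k} → k ≤ M → i + k ≤ L
    within k≤M = ≤-trans (+-monoʳ-≤ i k≤M) i+M≤L
    i+2+k : ∀ k → i + (2 + k) ≡ 2 + (i + k)
    i+2+k k = trans (+-suc i (suc k)) (cong suc (+-suc i k))
    step' : ∀ k → k < M → Adj G (u (i + k)) (u (i + suc k))
    step' k k<M = subst (λ s → Adj G (u (i + k)) (u s)) (sym (+-suc i k))
                    (step (i + k) (subst (_≤ L) (+-suc i k) (within k<M)))
    noReturn' : ∀ k → 2 + k ≤ M → u (i + k) ≢ u (i + (2 + k))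
    noReturn' k 2+k≤M = subst (λ s → u (i + k) ≢ u s) (sym (i+2+k k))
                          (noReturn (i + k) (subst (_≤ L) (i+2+k k) (within 2+k≤M)))

  cycleWithin-mono : ∀ {L L'} → L ≤ L' → CycleWithin L → CycleWithin L'
  cycleWithin-mono L≤L' (m , 3≤ , m≤L , cycle) = m , 3≤ , ≤-trans m≤L L≤L' , cycle

  girth⇒noCycle : ∀ t → GirthAtLeast G (2 * t + 1) → ¬ CycleWithin (2 * t)
  girth⇒noCycle t girth (m , 3≤ , m<2t , cycle) =
    girth m 3≤ (subst (suc m <_) (+-comm 1 (2 * t)) (s≤s m<2t)) cycle

  -- a closed non-backtracking walk has length at least 3: length 1 would need a
  -- loop and length 2 an immediate return
  closedWalk-length : ∀ {u L} → ClosedWalk u L → 3 ≤ L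
  closedWalk-length {u} {zero}    cw = ⊥-elim (1+n≰n (ClosedWalk.positive cw))
  closedWalk-length {u} {1}       cw = ⊥-elim (irrefl G (subst (Adj G (u 0)) closed (step 0 ≤-refl)))
    where
    open ClosedWalk cw
    open NonBacktracking walk
  closedWalk-length {u} {2}       cw = ⊥-elim (noReturn 0 ≤-refl (sym closed))
    where
    open ClosedWalk cw
    open NonBacktracking walk
  closedWalk-length {u} {suc (suc (suc L))} cw = s≤s (s≤s (s≤s z≤n))

  simple⇒cycle : ∀ {u m} → ClosedWalk u (suc m) →
                 (∀ {i j} → i < j → j < suc m → u i ≢ u j) → CycleWithin (suc m)
  simple⇒cycle {u} {m} cw distinct = m , closedWalk-length cw , ≤-refl , f , injective , steps , closing
    where
    open ClosedWalk cw
    open NonBacktracking walk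
    f : Fin (suc m) → Fin n
    f i = u (toℕ i)
    injective : ∀ {i j} → f i ≡ f j → i ≡ j
    injective {i} {j} fi≡fj with <-cmp (toℕ i) (toℕ j)
    ... | tri< i<j _ _ = ⊥-elim (distinct i<j (Fin.toℕ<n j) fi≡fj)
    ... | tri≈ _ i≡j _ = Fin.toℕ-injective i≡j
    ... | tri> _ _ j<i = ⊥-elim (distinct j<i (Fin.toℕ<n i) (sym fi≡fj))
    steps : ∀ (i : Fin m) → Adj G (f (inject₁ i)) (f (suc i))
    steps i = subst (λ s → Adj G (u s) (u (suc (toℕ i)))) (sym (Fin.toℕ-inject₁ i))
                (step (toℕ i) (m<n⇒m<1+n (Fin.toℕ<n i)))
    closing : Adj G (f (fromℕ m)) (f zero)
    closing = subst (λ s → Adj G (u s) (u 0)) (sym (Fin.toℕ-fromℕ m))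
                (subst (Adj G (u m)) closed (step m ≤-refl))

  -- every closed non-backtracking walk of length L contains a cycle of length at most L:
  -- either its vertices are distinct, or the segment between two visits of the same
  -- vertex is a shorter closed non-backtracking walk
  closedWalk⇒cycle : ∀ L u → ClosedWalk u L → CycleWithin L
  closedWalk⇒cycle = <-rec (λ L → ∀ u → ClosedWalk u L → CycleWithin L) shorten
    where
    shorten : ∀ L → (∀ {L'} → L' < L → ∀ u → ClosedWalk u L' → CycleWithin L') →
              ∀ u → ClosedWalk u L → CycleWithin L
    shorten L shorter u cw with anyUpTo? (λ j → anyUpTo? (λ i → u i Fin.≟ u j) j) L
    ... | yes (j , j<L , i , i<j , uᵢ≡uⱼ) =
      cycleWithin-mono (≤-trans (m∸n≤m j i) (<⇒≤ j<L))
        (shorter (≤-<-trans (m∸n≤m j i) j<L) (λ k → u (i + k)) segment)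
      where
      segment : ClosedWalk (λ k → u (i + k)) (j ∸ i)
      segment = record
        { positive = m<n⇒0<n∸m i<j
        ; walk     = nonBacktracking-shift i (j ∸ i) (ClosedWalk.walk cw)
                       (≤-trans (≤-reflexive (m+[n∸m]≡n (<⇒≤ i<j))) (<⇒≤ j<L))
        ; closed   = trans (cong u (m+[n∸m]≡n (<⇒≤ i<j))) (trans (sym uᵢ≡uⱼ) (cong u (sym (+-identityʳ i))))
        }
    ... | no noRepeat with L
    ...   | zero  = ⊥-elim (1+n≰n (ClosedWalk.positive cw))
    ...   | suc m = simple⇒cycle cw (λ {i} {j} i<j j<L uᵢ≡uⱼ → noRepeat (j , j<L , i , i<j , uᵢ≡uⱼ))

  -- Two non-backtracking walks a, b of length L from a common start, leaving it along
  -- different edges and ending at a common vertex, glue (a backwards, then b) into a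
  -- closed non-backtracking walk of length L + L.
  module Glue (a b : ℕ → Fin n) (L : ℕ) (positive : 1 ≤ L)
              (walk-a : NonBacktracking a L) (walk-b : NonBacktracking b L)
              (start : a 0 ≡ b 0) (diverge : a 1 ≢ b 1) (end : a L ≡ b L) where

    open NonBacktracking

    glued : ℕ → Fin n
    glued k with k ≤? L
    ... | yes _ = a (L ∸ k)
    ... | no  _ = b (k ∸ L)

    glued-a : ∀ {k} → k ≤ L → glued k ≡ a (L ∸ k)
    glued-a {k} k≤L with k ≤? L
    ... | yes _   = refl
    ... | no  k≰L = ⊥-elim (k≰L k≤L)

    glued-b : ∀ {k} → L ≤ k → glued k ≡ b (k ∸ L)
    glued-b {k} L≤k with k ≤? L
    ... | no  _   = refl
    ... | yes k≤L with ≤-antisym L≤k k≤L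
    ...   | refl = trans (cong a (n∸n≡0 L)) (trans start (cong b (sym (n∸n≡0 L))))

    b-index : ∀ m {k} → L ≤ k → m + k ≤ L + L → m + (k ∸ L) ≤ L
    b-index m {k} L≤k bound = begin
      m + (k ∸ L)    ≡⟨ +-∸-assoc m L≤k ⟨
      m + k ∸ L      ≤⟨ ∸-monoˡ-≤ L bound ⟩
      L + L ∸ L      ≡⟨ m+n∸n≡m L L ⟩
      L              ∎
      where open ≤-Reasoning

    step-glued : ∀ k → k < L + L → Adj G (glued k) (glued (suc k))
    step-glued k k<2L = [ along-a , along-b ]′ (<-≤-connex k L)
      where
      along-a : k < L → Adj G (glued k) (glued (suc k))
      along-a k<L = subst₂ (Adj G) (sym (glued-a (<⇒≤ k<L))) (sym (glued-a k<L))
                      (Graph.sym G (subst (λ s → Adj G (a (L ∸ suc k)) (a s)) (sym L∸k)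
                        (step walk-a (L ∸ suc k) (subst (_≤ L) L∸k (m∸n≤m L k)))))
        where
        L∸k : L ∸ k ≡ 1 + (L ∸ suc k)
        L∸k = ∸-split 1 k L k<L
      along-b : L ≤ k → Adj G (glued k) (glued (suc k))
      along-b L≤k = subst₂ (Adj G) (sym (glued-b L≤k)) (sym (glued-b (m≤n⇒m≤1+n L≤k)))
                      (subst (λ s → Adj G (b (k ∸ L)) (b s)) (sym (+-∸-assoc 1 L≤k))
                        (step walk-b (k ∸ L) (b-index 1 L≤k k<2L)))

    noReturn-in-a : ∀ k → 2 + k ≤ L → glued k ≢ glued (2 + k)
    noReturn-in-a k 2+k≤L same = noReturn walk-a (L ∸ (2 + k)) (subst (_≤ L) L∸k (m∸n≤m L k)) (begin
      a (L ∸ (2 + k))        ≡⟨ glued-a 2+k≤L ⟨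
      glued (2 + k)          ≡⟨ same ⟨
      glued k                ≡⟨ glued-a (≤-trans (m≤n+m k 2) 2+k≤L) ⟩
      a (L ∸ k)              ≡⟨ cong a L∸k ⟩
      a (2 + (L ∸ (2 + k)))  ∎)
      where
      open ≡-Reasoning
      L∸k : L ∸ k ≡ 2 + (L ∸ (2 + k))
      L∸k = ∸-split 2 k L 2+k≤L

    noReturn-in-b : ∀ k → L ≤ k → 2 + k ≤ L + L → glued k ≢ glued (2 + k)
    noReturn-in-b k L≤k 2+k≤2L same = noReturn walk-b (k ∸ L) (b-index 2 L≤k 2+k≤2L) (begin
      b (k ∸ L)              ≡⟨ glued-b L≤k ⟨
      glued k                ≡⟨ same ⟩
      glued (2 + k)          ≡⟨ glued-b (≤-trans L≤k (m≤n+m k 2)) ⟩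
      b (2 + k ∸ L)          ≡⟨ cong b (+-∸-assoc 2 L≤k) ⟩
      b (2 + (k ∸ L))        ∎)
      where open ≡-Reasoning

    -- at the junction, k and 2 + k sit on either side of the common start,
    -- where the walks a and b leave along different edges
    noReturn-at-start : ∀ k → k < L → L < 2 + k → glued k ≢ glued (2 + k)
    noReturn-at-start k k<L L<2+k same = diverge (begin
      a 1                    ≡⟨ cong a L∸k≡1 ⟨
      a (L ∸ k)              ≡⟨ glued-a (<⇒≤ k<L) ⟨
      glued k                ≡⟨ same ⟩
      glued (2 + k)          ≡⟨ glued-b (<⇒≤ L<2+k) ⟩
      b (2 + k ∸ L)          ≡⟨ cong b 2+k∸L≡1 ⟩
      b 1                    ∎)
      where
      open ≡-Reasoning
      L≡1+k : L ≡ suc k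
      L≡1+k = ≤-antisym (≤-pred L<2+k) k<L
      L∸k≡1 : L ∸ k ≡ 1
      L∸k≡1 = trans (cong (_∸ k) L≡1+k) (m+n∸n≡m 1 k)
      2+k∸L≡1 : 2 + k ∸ L ≡ 1
      2+k∸L≡1 = trans (cong (2 + k ∸_) L≡1+k) (m+n∸n≡m 1 (suc k))

    noReturn-glued : ∀ k → 2 + k ≤ L + L → glued k ≢ glued (2 + k)
    noReturn-glued k 2+k≤2L with ≤-<-connex (2 + k) L
    ... | inj₁ 2+k≤L = noReturn-in-a k 2+k≤L
    ... | inj₂ L<2+k with <-≤-connex k L
    ...   | inj₁ k<L = noReturn-at-start k k<L L<2+k
    ...   | inj₂ L≤k = noReturn-in-b k L≤k 2+k≤2L

    closedWalk : ClosedWalk glued (L + L)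
    closedWalk = record
      { positive = ≤-trans positive (m≤m+n L L)
      ; walk     = record { step = step-glued ; noReturn = noReturn-glued }
      ; closed   = trans (glued-b (m≤m+n L L))
                     (trans (cong b (m+n∸n≡m L L)) (trans (sym end) (sym (glued-a z≤n))))
      }

lookup-injective : ∀ {A : Set} {xs : List A} → Unique xs →
                   ∀ {i j} → lookup xs i ≡ lookup xs j → i ≡ j
lookup-injective (_  ∷ _)      {zero}  {zero}  _ = refl
lookup-injective (x∉ ∷ _)      {zero}  {suc j} e = ⊥-elim (All.lookup x∉ (∈-lookup j) e)
lookup-injective (x∉ ∷ _)      {suc i} {zero}  e = ⊥-elim (All.lookup x∉ (∈-lookup i) (sym e))
lookup-injective (_  ∷ unique) {suc i} {suc j} e = cong suc (lookup-injective unique e)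

length-remove : ∀ {n} (p : Fin n) xs → Unique xs →
                length xs ≤ suc (length (filter (λ y → ¬? (y Fin.≟ p)) xs))
length-remove p []       _ = z≤n
length-remove p (x ∷ xs) (x∉ ∷ unique) with x Fin.≟ p
... | yes refl = s≤s (≤-reflexive (cong length (sym (filter-all (λ y → ¬? (y Fin.≟ x))
                                                      (All.map (λ x≢y y≡x → x≢y (sym y≡x)) x∉)))))
... | no _     = s≤s (length-remove p xs unique)

module Branching {n : ℕ} (G : Graph n) where

  -- b distinct neighbours of x, all different from p: the possible continuations
  -- of a non-backtracking walk that arrived at x from p
  record Branches (b : ℕ) (x p : Fin n) : Set where
    field
      child    : Fin b → Fin n
      adjacent : ∀ i → Adj G x (child i)
      avoids   : ∀ i → child i ≢ p
      distinct : ∀ {i j} → child i ≡ child j → i ≡ j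

  branches : ∀ b x p → suc b ≤ degree G x → Branches b x p
  branches b x p deg = record
    { child    = child
    ; adjacent = λ i → proj₁ (candidate (member i))
    ; avoids   = λ i → proj₂ (candidate (member i))
    ; distinct = λ same → Fin.inject≤-injective _ _ _ _ (lookup-injective unique same)
    }
    where
    avoid? : ∀ y → Dec (y ≢ p)
    avoid? y = ¬? (y Fin.≟ p)
    neighbours candidates : List (Fin n)
    neighbours = filter (adj? G x) (allFin n)
    candidates = filter avoid? neighbours
    unique-neighbours : Unique neighbours
    unique-neighbours = Unique.filter⁺ (adj? G x) (Unique.allFin⁺ n)
    unique : Unique candidates
    unique = Unique.filter⁺ avoid? unique-neighbours
    enough : b ≤ length candidates
    enough = ≤-pred (≤-trans deg (length-remove p neighbours unique-neighbours))
    child : Fin b → Fin n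
    child i = lookup candidates (inject≤ i enough)
    member : ∀ i → child i ∈ candidates
    member i = ∈-lookup (inject≤ i enough)
    candidate : ∀ {y} → y ∈ candidates → Adj G x y × y ≢ p
    candidate y∈ with ∈-filter⁻ avoid? {xs = neighbours} y∈
    ... | y∈neighbours , y≢p = proj₂ (∈-filter⁻ (adj? G x) {xs = allFin n} y∈neighbours) , y≢p

-- The b-ary tree of non-backtracking walks. In a graph with no cycle of length at
-- most 2t, its leaves at depth r ≤ t are pairwise distinct vertices, so every ball
-- of radius r contains at least b ^ r vertices.
module Tree {n : ℕ} (G : Graph n) {b : ℕ} (branch : ∀ x p → Branching.Branches G b x p) where

  open Pebbling G using (Within; within?; within-sym)
  open Cycles G
  open Branching.Branches

  Leaf : ℕ → Fin n → Fin n → Fin n → Set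
  Leaf zero    x p z = z ≡ x
  Leaf (suc r) x p z = ∃[ i ] Leaf r (child (branch x p) i) x z

  leaf? : ∀ r x p z → Dec (Leaf r x p z)
  leaf? zero    x p z = z Fin.≟ x
  leaf? (suc r) x p z = Fin.any? (λ i → leaf? r (child (branch x p) i) x z)

  leaf⇒within : ∀ r {x p z} → Leaf r x p z → Within r x z
  leaf⇒within zero            z≡x        = sym z≡x
  leaf⇒within (suc r) {x} {p} (i , leaf) = inj₂ (_ , adjacent (branch x p) i , leaf⇒within r leaf)

  record WalkTo (r : ℕ) (x p z : Fin n) : Set where
    field
      walk      : ℕ → Fin n
      start     : walk 0 ≡ x
      end       : walk r ≡ z
      nonBacktracking : NonBacktracking walk r
      firstStep : 1 ≤ r → walk 1 ≢ p

  prepend : ∀ {r x y q z} → Adj G x y → y ≢ q → WalkTo r y x z → WalkTo (suc r) x q z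
  prepend {r} {x} {y} {q} {z} x~y y≢q w = record
    { walk = walk'
    ; start = refl
    ; end = end
    ; nonBacktracking = record { step = step' ; noReturn = noReturn' }
    ; firstStep = λ _ y≡q → y≢q (trans (sym start) y≡q)
    }
    where
    open WalkTo w
    walk' : ℕ → Fin n
    walk' zero    = x
    walk' (suc k) = walk k
    step' : ∀ k → k < suc r → Adj G (walk' k) (walk' (suc k))
    step' zero    _         = subst (Adj G x) (sym start) x~y
    step' (suc k) (s≤s k<r) = NonBacktracking.step nonBacktracking k k<r
    noReturn' : ∀ k → 2 + k ≤ suc r → walk' k ≢ walk' (2 + k)
    noReturn' zero    (s≤s 1≤r)   = λ x≡w1 → firstStep 1≤r (sym x≡w1)
    noReturn' (suc k) (s≤s 2+k≤r) = NonBacktracking.noReturn nonBacktracking k 2+k≤r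

  walkTo : ∀ r {x p z} → Leaf r x p z → WalkTo r x p z
  walkTo zero {x} z≡x = record
    { walk = λ _ → x ; start = refl ; end = sym z≡x
    ; nonBacktracking = record { step = λ _ () ; noReturn = λ _ () } ; firstStep = λ () }
  walkTo (suc r) {x} {p} (i , leaf) =
    prepend (adjacent (branch x p) i) (avoids (branch x p) i) (walkTo r leaf)

  module _ (t : ℕ) (noCycle : ¬ CycleWithin (2 * t)) where

    -- leaves of different branches at depth r + 1 ≤ t are different vertices:
    -- otherwise the two walks glue into a closed walk of length at most 2t
    branches-disjoint : ∀ r → suc r ≤ t → ∀ {x p z i j} →
      Leaf r (child (branch x p) i) x z → Leaf r (child (branch x p) j) x z → i ≡ j
    branches-disjoint r r<t {x} {p} {z} {i} {j} leafᵢ leafⱼ with i Fin.≟ j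
    ... | yes i≡j = i≡j
    ... | no  i≢j = ⊥-elim (noCycle (cycleWithin-mono length≤2t (closedWalk⇒cycle _ _ closedWalk)))
      where
      via : ∀ k → Leaf r (child (branch x p) k) x z → WalkTo (suc r) x x z
      via k leaf = prepend (adjacent (branch x p) k)
                     (λ y≡x → irrefl G (subst (Adj G x) y≡x (adjacent (branch x p) k))) (walkTo r leaf)
      A B : WalkTo (suc r) x x z
      A = via i leafᵢ
      B = via j leafⱼ
      diverge : WalkTo.walk A 1 ≢ WalkTo.walk B 1
      diverge same = i≢j (distinct (branch x p)
        (trans (sym (WalkTo.start (walkTo r leafᵢ))) (trans same (WalkTo.start (walkTo r leafⱼ)))))
      end : WalkTo.walk A (suc r) ≡ WalkTo.walk B (suc r)
      end = trans (WalkTo.end A) (sym (WalkTo.end B))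
      open Glue (WalkTo.walk A) (WalkTo.walk B) (suc r) (s≤s z≤n)
                (WalkTo.nonBacktracking A) (WalkTo.nonBacktracking B) refl diverge end
        using (closedWalk)
      length≤2t : suc r + suc r ≤ 2 * t
      length≤2t = subst (suc r + suc r ≤_) (cong (t +_) (sym (+-identityʳ t))) (+-mono-≤ r<t r<t)

    leaves : ∀ r → r ≤ t → ∀ x p → b ^ r ≤ ∑ (λ z → 𝟙 (does (leaf? r x p z)))
    leaves zero    _   x p = ≤-reflexive (sym (∑-point x))
    leaves (suc r) r<t x p = begin
      b * b ^ r
        ≡⟨ ∑-const b (b ^ r) ⟨
      ∑ {b} (λ i → b ^ r)
        ≤⟨ ∑-mono (λ i → leaves r (<⇒≤ r<t) (child (branch x p) i) x) ⟩
      ∑ (λ i → ∑ (λ z → 𝟙 (does (leaf? r (child (branch x p) i) x z))))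
        ≡⟨ ∑-comm (λ i z → 𝟙 (does (leaf? r (child (branch x p) i) x z))) ⟩
      ∑ (λ z → ∑ (λ i → 𝟙 (does (leaf? r (child (branch x p) i) x z))))
        ≡⟨ sum-cong-≗ (λ z → 𝟙-any (λ i → leaf? r (child (branch x p) i) x z) (branches-disjoint r r<t)) ⟨
      ∑ (λ z → 𝟙 (does (leaf? (suc r) x p z)))
        ∎
      where open ≤-Reasoning

    ball : ∀ r → r ≤ t → ∀ x → b ^ r ≤ ∑ (λ w → 𝟙 (does (within? r w x)))
    ball r r≤t x = ≤-trans (leaves r r≤t x x)
      (∑-mono (λ w → 𝟙-mono (leaf? r x x w) (within? r w x) (within-sym r ∘ leaf⇒within r)))

-- Greedily choosing centres that cover many
-- uncovered points halves the uncovered set using at most 2n/d centres; J rounds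
-- leave at most n / 2^J points uncovered using at most 2nJ/d centres.
module Covering {n : ℕ} (R : Fin n → Fin n → Bool) (d : ℕ) (1≤d : 1 ≤ d)
                (covered : ∀ x → d ≤ ∑ (λ w → 𝟙 (R w x))) where

  _∖_ : (Fin n → Bool) → Fin n → Fin n → Bool
  (W ∖ w) x = W x ∧ not (R w x)

  hits : (Fin n → Bool) → Fin n → ℕ
  hits W w = ∑ (λ x → 𝟙 (W x ∧ R w x))

  Covers : List (Fin n) → (Fin n → Bool) → (Fin n → Bool) → Set
  Covers S W W' = ∀ x → W x ≡ true → W' x ≡ true ⊎ ∃[ s ] (s ∈ S × R s x ≡ true)

  covers-refl : ∀ W → Covers [] W W
  covers-refl W x Wx = inj₁ Wx

  covers-cons : ∀ {S W W'} w → Covers S (W ∖ w) W' → Covers (w ∷ S) W W'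
  covers-cons {W = W} w covers x Wx with R w x in Rwx
  ... | true  = inj₂ (w , here refl , Rwx)
  ... | false with covers x (cong₂ (λ a c → a ∧ not c) Wx Rwx)
  ...   | inj₁ W'x           = inj₁ W'x
  ...   | inj₂ (s , s∈ , Rsx) = inj₂ (s , there s∈ , Rsx)

  covers-++ : ∀ {S₁ S₂ W₁ W₂ W₃} → Covers S₁ W₁ W₂ → Covers S₂ W₂ W₃ → Covers (S₁ ++ S₂) W₁ W₃
  covers-++ {S₁} covers₁ covers₂ x W₁x with covers₁ x W₁x
  ... | inj₂ (s , s∈ , Rsx) = inj₂ (s , ∈-++⁺ˡ s∈ , Rsx)
  ... | inj₁ W₂x with covers₂ x W₂x
  ...   | inj₁ W₃x           = inj₁ W₃x
  ...   | inj₂ (s , s∈ , Rsx) = inj₂ (s , ∈-++⁺ʳ S₁ s∈ , Rsx)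

  split : ∀ W w → ∣ W ∣ ≡ hits W w + ∣ W ∖ w ∣
  split W w = trans (sum-cong-≗ (λ x → 𝟙-split (W x) (R w x)))
                    (∑-distrib-+ (λ x → 𝟙 (W x ∧ R w x)) (λ x → 𝟙 ((W ∖ w) x)))
    where
    𝟙-split : ∀ a c → 𝟙 a ≡ 𝟙 (a ∧ c) + 𝟙 (a ∧ not c)
    𝟙-split false c     = refl
    𝟙-split true  true  = refl
    𝟙-split true  false = refl

  removal-shrinks : ∀ W w → 1 ≤ hits W w → ∣ W ∖ w ∣ < ∣ W ∣
  removal-shrinks W w 1≤hits = subst (∣ W ∖ w ∣ <_) (sym (split W w)) (+-monoˡ-≤ ∣ W ∖ w ∣ 1≤hits)

  -- double counting the covered pairs: the centres together cover W at least d times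
  double-count : ∀ W → ∣ W ∣ * d ≤ ∑ (hits W)
  double-count W = begin
    ∣ W ∣ * d                                      ≡⟨ *-comm ∣ W ∣ d ⟩
    d * ∣ W ∣                                      ≡⟨ *-distribˡ-sum d (𝟙 ∘ W) ⟩
    ∑ (λ x → d * 𝟙 (W x))                          ≤⟨ ∑-mono (λ x → ≤-trans (≤-reflexive (*-comm d (𝟙 (W x))))
                                                                        (*-monoʳ-≤ (𝟙 (W x)) (covered x))) ⟩
    ∑ (λ x → 𝟙 (W x) * ∑ (λ w → 𝟙 (R w x)))        ≡⟨ sum-cong-≗ (λ x → restrict (W x) x) ⟩
    ∑ (λ x → ∑ (λ w → 𝟙 (W x ∧ R w x)))            ≡⟨ ∑-comm (λ x w → 𝟙 (W x ∧ R w x)) ⟩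
    ∑ (hits W)                                     ∎
    where
    open ≤-Reasoning
    restrict : ∀ a x → 𝟙 a * ∑ (λ w → 𝟙 (R w x)) ≡ ∑ (λ w → 𝟙 (a ∧ R w x))
    restrict true  x = +-identityʳ _
    restrict false x = sym (∑-zero n)

  good-centre : ∀ W → 1 ≤ ∣ W ∣ → ∃[ w ] (∣ W ∣ * d ≤ n * hits W w × 1 ≤ hits W w)
  good-centre W 1≤∣W∣ = centre (∑-average (hits W))
    where
    1≤∣W∣d : 1 ≤ ∣ W ∣ * d
    1≤∣W∣d = *-mono-≤ 1≤∣W∣ 1≤d
    centre : ∑ (hits W) ≡ 0 ⊎ ∃[ w ] (∑ (hits W) ≤ n * hits W w) →
             ∃[ w ] (∣ W ∣ * d ≤ n * hits W w × 1 ≤ hits W w)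
    centre (inj₁ noHits)    = ⊥-elim (1+n≰n (≤-trans 1≤∣W∣d (≤-trans (double-count W) (≤-reflexive noHits))))
    centre (inj₂ (w , best)) = w , many , positive-factor n (≤-trans 1≤∣W∣d many)
      where
      many : ∣ W ∣ * d ≤ n * hits W w
      many = ≤-trans (double-count W) best

  greedy-step : ∀ v W → v < 2 * ∣ W ∣ → ∃[ w ] (v * d ≤ 2 * n * hits W w × 1 ≤ hits W w)
  greedy-step v W v<2∣W∣ with good-centre W (positive-factor 2 (≤-trans (s≤s z≤n) v<2∣W∣))
  ... | w , many , 1≤hits = w , gain , 1≤hits
    where
    gain : v * d ≤ 2 * n * hits W w
    gain = begin
      v * d                 ≤⟨ *-monoˡ-≤ d (<⇒≤ v<2∣W∣) ⟩
      2 * ∣ W ∣ * d         ≡⟨ *-assoc 2 ∣ W ∣ d ⟩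
      2 * (∣ W ∣ * d)       ≤⟨ *-monoʳ-≤ 2 many ⟩
      2 * (n * hits W w)    ≡⟨ *-assoc 2 n (hits W w) ⟨
      2 * n * hits W w      ∎
      where open ≤-Reasoning

  HalvedBy : ℕ → (Fin n → Bool) → Set
  HalvedBy v W = ∃[ S ] ∃[ W' ] (v * (length S * d) ≤ 2 * n * ∣ W ∣ × 2 * ∣ W' ∣ ≤ v × Covers S W W')

  halving : ∀ v W → HalvedBy v W
  halving v W = <-rec (λ s → ∀ W → ∣ W ∣ ≡ s → HalvedBy v W) step ∣ W ∣ W refl
    where
    step : ∀ s → (∀ {s'} → s' < s → ∀ W → ∣ W ∣ ≡ s' → HalvedBy v W) →
           ∀ W → ∣ W ∣ ≡ s → HalvedBy v W
    step _ smaller W refl with 2 * ∣ W ∣ ≤? v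
    ... | yes few  = [] , W , ≤-trans (≤-reflexive (*-zeroʳ v)) z≤n , few , covers-refl W
    ... | no  many with greedy-step v W (≰⇒> many)
    ...   | w , gain , 1≤hits with smaller (removal-shrinks W w 1≤hits) (W ∖ w) refl
    ...     | S , W' , used , few , covers = w ∷ S , W' , used' , few , covers-cons w covers
      where
      used' : v * (length (w ∷ S) * d) ≤ 2 * n * ∣ W ∣
      used' = begin
        v * (d + length S * d)               ≡⟨ *-distribˡ-+ v d (length S * d) ⟩
        v * d + v * (length S * d)           ≤⟨ +-mono-≤ gain used ⟩
        2 * n * hits W w + 2 * n * ∣ W ∖ w ∣ ≡⟨ *-distribˡ-+ (2 * n) (hits W w) ∣ W ∖ w ∣ ⟨
        2 * n * (hits W w + ∣ W ∖ w ∣)       ≡⟨ cong (2 * n *_) (split W w) ⟨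
        2 * n * ∣ W ∣                        ∎
        where open ≤-Reasoning

  halve : ∀ W → ∃[ S ] ∃[ W' ] (length S * d ≤ 2 * n × 2 * ∣ W' ∣ ≤ ∣ W ∣ × Covers S W W')
  halve W with ∣ W ∣ in size
  ... | zero  = [] , W , z≤n , ≤-reflexive (cong (2 *_) size) , covers-refl W
  ... | suc v with halving (suc v) W
  ...   | S , W' , used , few , covers = S , W' , *-cancelˡ-≤ (suc v) used' , few , covers
    where
    used' : suc v * (length S * d) ≤ suc v * (2 * n)
    used' = ≤-trans used (≤-reflexive (trans (cong (2 * n *_) size) (*-comm (2 * n) (suc v))))

  cover : ∀ J W → ∃[ S ] ∃[ W' ] (length S * d ≤ 2 * n * J × ∣ W' ∣ * 2 ^ J ≤ ∣ W ∣ × Covers S W W')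
  cover zero    W = [] , W , z≤n , ≤-reflexive (*-identityʳ ∣ W ∣) , covers-refl W
  cover (suc J) W with halve W
  ... | S₁ , W₁ , used₁ , few₁ , covers₁ with cover J W₁
  ...   | S₂ , W₂ , used₂ , few₂ , covers₂ = S₁ ++ S₂ , W₂ , used , few , covers-++ covers₁ covers₂
    where
    used : length (S₁ ++ S₂) * d ≤ 2 * n * suc J
    used = begin
      length (S₁ ++ S₂) * d             ≡⟨ cong (_* d) (length-++ S₁) ⟩
      (length S₁ + length S₂) * d       ≡⟨ *-distribʳ-+ d (length S₁) (length S₂) ⟩
      length S₁ * d + length S₂ * d     ≤⟨ +-mono-≤ used₁ used₂ ⟩
      2 * n + 2 * n * J                 ≡⟨ *-suc (2 * n) J ⟨
      2 * n * suc J                     ∎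
      where open ≤-Reasoning
    few : ∣ W₂ ∣ * 2 ^ suc J ≤ ∣ W ∣
    few = begin
      ∣ W₂ ∣ * (2 * 2 ^ J)    ≡⟨ *-comm ∣ W₂ ∣ (2 * 2 ^ J) ⟩
      2 * 2 ^ J * ∣ W₂ ∣      ≡⟨ *-assoc 2 (2 ^ J) ∣ W₂ ∣ ⟩
      2 * (2 ^ J * ∣ W₂ ∣)    ≤⟨ *-monoʳ-≤ 2 (subst (_≤ ∣ W₁ ∣) (*-comm ∣ W₂ ∣ (2 ^ J)) few₂) ⟩
      2 * ∣ W₁ ∣              ≤⟨ few₁ ⟩
      ∣ W ∣                   ∎
      where open ≤-Reasoning

module Piles {n : ℕ} where

  occurrences : Fin n → List (Fin n) → ℕ
  occurrences x []      = 0
  occurrences x (s ∷ S) = 𝟙 (does (x Fin.≟ s)) + occurrences x S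

  ∑-occurrences : ∀ S → ∑ (λ x → occurrences x S) ≡ length S
  ∑-occurrences []      = ∑-zero n
  ∑-occurrences (s ∷ S) = trans (∑-distrib-+ (λ x → 𝟙 (does (x Fin.≟ s))) (λ x → occurrences x S))
                                (cong₂ _+_ (∑-point s) (∑-occurrences S))

  occurrences-∈ : ∀ {s S} → s ∈ S → 1 ≤ occurrences s S
  occurrences-∈ {s} (here refl) with s Fin.≟ s
  ... | yes _   = s≤s z≤n
  ... | no s≢s = ⊥-elim (s≢s refl)
  occurrences-∈ {s} {x ∷ S} (there s∈S) = ≤-trans (occurrences-∈ s∈S) (m≤n+m (occurrences s S) _)

  piles : ℕ → List (Fin n) → (Fin n → Bool) → Distribution n
  piles r S W' x = 2 ^ r * (occurrences x S + 𝟙 (W' x))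

  size-piles : ∀ r S W' → size (piles r S W') ≡ 2 ^ r * (length S + ∣ W' ∣)
  size-piles r S W' = begin
    size (piles r S W')                                  ≡⟨ size≡∑ (piles r S W') ⟩
    ∑ (λ x → 2 ^ r * (occurrences x S + 𝟙 (W' x)))       ≡⟨ *-distribˡ-sum (2 ^ r) (λ x → occurrences x S + 𝟙 (W' x)) ⟨
    2 ^ r * ∑ (λ x → occurrences x S + 𝟙 (W' x))         ≡⟨ cong (2 ^ r *_) (∑-distrib-+ (λ x → occurrences x S) (𝟙 ∘ W')) ⟩
    2 ^ r * (∑ (λ x → occurrences x S) + ∣ W' ∣)         ≡⟨ cong (λ l → 2 ^ r * (l + ∣ W' ∣)) (∑-occurrences S) ⟩
    2 ^ r * (length S + ∣ W' ∣)                          ∎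
    where open ≡-Reasoning

  full-pile : ∀ r S W' x → 1 ≤ occurrences x S + 𝟙 (W' x) → 2 ^ r ≤ piles r S W' x
  full-pile r S W' x present = subst (_≤ piles r S W' x) (*-identityʳ (2 ^ r)) (*-monoʳ-≤ (2 ^ r) present)

module Construction {n : ℕ} (G : Graph n) (degree≥4 : ∀ x → 4 ≤ degree G x)
                    (t : ℕ) (noCycle : ¬ Cycles.CycleWithin G (2 * t)) (r : ℕ) (r≤t : r ≤ t) where

  open Pebbling G
  open Piles

  -- degree ≥ 4 leaves three branches avoiding the previous vertex
  ball : ∀ x → 3 ^ r ≤ ∑ (λ w → 𝟙 (does (within? r w x)))
  ball = Tree.ball G (λ x p → Branching.branches G 3 x p (degree≥4 x)) t noCycle r r≤t

  open Covering (λ w x → does (within? r w x)) (3 ^ r) (m^n>0 3 r) ball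

  -- every vertex is a leftover carrying a pile, or within distance r of a centre
  solvable-piles : ∀ {S W'} → Covers S (λ _ → true) W' → Solvable G (piles r S W')
  solvable-piles {S} {W'} covers x with covers x refl
  ... | inj₁ W'x = pile-reaches r x x (piles r S W') (within-refl r x)
                     (full-pile r S W' x (≤-trans (≤-reflexive (cong 𝟙 (sym W'x))) (m≤n+m _ _)))
  ... | inj₂ (s , s∈S , Rsx) = pile-reaches r s x (piles r S W') (evidence (within? r s x) Rsx)
                                 (full-pile r S W' s (≤-trans (occurrences-∈ s∈S) (m≤m+n _ _)))

  sparse-solvable : ∀ J → ∃[ D ] (Solvable G D × ∃[ l ] ∃[ w ]
    (size D ≡ 2 ^ r * (l + w) × l * 3 ^ r ≤ 2 * n * J × w * 2 ^ J ≤ n))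
  sparse-solvable J with cover J (λ _ → true)
  ... | S , W' , used , few , covers =
    piles r S W' , solvable-piles covers , length S , ∣ W' ∣ ,
    size-piles r S W' , used , ≤-trans few (∣∣≤ (λ _ → true))

n<2^n : ∀ s → s < 2 ^ s
n<2^n zero    = s≤s z≤n
n<2^n (suc s) = subst (suc (suc s) ≤_) (cong (2 ^ s +_) (sym (+-identityʳ (2 ^ s))))
                  (+-mono-≤ (m^n>0 2 s) (n<2^n s))

-- since (3/2)^4 > 4, the factor 3^r / 2^r beats any linear factor: for s = c (4 + a)
-- and r = 4s, already c (r + a) 2^r ≤ (4^s) 2^r = 64^s ≤ 81^s = 3^r
growth : ∀ c a s → 1 ≤ c → s ≡ c * (4 + a) → c * (4 * s + a) * 2 ^ (4 * s) ≤ 3 ^ (4 * s)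
growth c a s 1≤c refl = begin
  c * (4 * s + a) * 2 ^ (4 * s)        ≤⟨ *-monoˡ-≤ (2 ^ (4 * s)) linear≤ ⟩
  2 ^ (s + s) * 2 ^ (4 * s)            ≡⟨ ^-distribˡ-+-* 2 (s + s) (4 * s) ⟨
  2 ^ (s + s + 4 * s)                  ≡⟨ cong (2 ^_) (six s) ⟩
  2 ^ (6 * s)                          ≡⟨ ^-*-assoc 2 6 s ⟨
  64 ^ s                               ≤⟨ ^-monoˡ-≤ s (m≤m+n 64 17) ⟩
  81 ^ s                               ≡⟨ ^-*-assoc 3 4 s ⟩
  3 ^ (4 * s)                          ∎
  where
  open ≤-Reasoning
  six : ∀ s → s + s + 4 * s ≡ 6 * s
  six = solve-∀
  square : ∀ c a s → c * (4 * s + s * a) ≡ s * (c * (4 + a))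
  square = solve-∀
  1≤s : 1 ≤ s
  1≤s = ≤-trans 1≤c (≤-trans (≤-reflexive (sym (*-identityʳ c))) (*-monoʳ-≤ c (s≤s z≤n)))
  linear≤ : c * (4 * s + a) ≤ 2 ^ (s + s)
  linear≤ = begin
    c * (4 * s + a)          ≤⟨ *-monoʳ-≤ c (+-monoʳ-≤ (4 * s) (subst (_≤ s * a) (*-identityˡ a) (*-monoˡ-≤ a 1≤s))) ⟩
    c * (4 * s + s * a)      ≡⟨ square c a s ⟩
    s * s                    ≤⟨ *-mono-≤ (<⇒≤ (n<2^n s)) (<⇒≤ (n<2^n s)) ⟩
    2 ^ s * 2 ^ s            ≡⟨ ^-distribˡ-+-* 2 s s ⟨
    2 ^ (s + s)              ∎

-- With 2q ≤ 2^a, 4q (r + a) 2^r ≤ 3^r and J = r + a, the bounds of the construction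
-- give 2^r (l + w) q ≤ n: each of the two parts contributes at most n / 2.
density : ∀ {n q r a l w} → 2 * q ≤ 2 ^ a → 4 * q * (r + a) * 2 ^ r ≤ 3 ^ r →
          l * 3 ^ r ≤ 2 * n * (r + a) → w * 2 ^ (r + a) ≤ n → 2 ^ r * (l + w) * q ≤ n
density {n} {q} {r} {a} {l} {w} 2q≤2^a growing centres leftovers = *-cancelˡ-≤ 2 (begin
  2 * (2 ^ r * (l + w) * q)                      ≡⟨ halves (2 ^ r) l w q ⟩
  2 ^ r * l * (2 * q) + 2 ^ r * w * (2 * q)      ≤⟨ +-mono-≤ centre-part leftover-part ⟩
  n + n                                          ≡⟨ cong (n +_) (+-identityʳ n) ⟨
  2 * n                                          ∎)
  where
  open ≤-Reasoning
  halves : ∀ x l w q → 2 * (x * (l + w) * q) ≡ x * l * (2 * q) + x * w * (2 * q)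
  halves = solve-∀
  regroup : ∀ x l q y → x * l * (2 * q) * y ≡ l * y * (2 * q * x)
  regroup = solve-∀
  expand : ∀ n j q x → 2 * n * j * (2 * q * x) ≡ n * (4 * q * j * x)
  expand = solve-∀
  centre-part : 2 ^ r * l * (2 * q) ≤ n
  centre-part = *-cancelʳ-≤ _ n (3 ^ r) {{m^n≢0 3 r}} (begin
    2 ^ r * l * (2 * q) * 3 ^ r                ≡⟨ regroup (2 ^ r) l q (3 ^ r) ⟩
    l * 3 ^ r * (2 * q * 2 ^ r)                ≤⟨ *-monoˡ-≤ (2 * q * 2 ^ r) centres ⟩
    2 * n * (r + a) * (2 * q * 2 ^ r)          ≡⟨ expand n (r + a) q (2 ^ r) ⟩
    n * (4 * q * (r + a) * 2 ^ r)              ≤⟨ *-monoʳ-≤ n growing ⟩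
    n * 3 ^ r                                  ∎)
  leftover-part : 2 ^ r * w * (2 * q) ≤ n
  leftover-part = begin
    2 ^ r * w * (2 * q)     ≤⟨ *-monoʳ-≤ (2 ^ r * w) 2q≤2^a ⟩
    2 ^ r * w * 2 ^ a       ≡⟨ cong (_* 2 ^ a) (*-comm (2 ^ r) w) ⟩
    w * 2 ^ r * 2 ^ a       ≡⟨ *-assoc w (2 ^ r) (2 ^ a) ⟩
    w * (2 ^ r * 2 ^ a)     ≡⟨ cong (w *_) (^-distribˡ-+-* 2 r a) ⟨
    w * 2 ^ (r + a)         ≤⟨ leftovers ⟩
    n                       ∎

-- We take a = q + 1 (so 2q ≤ 2^a), T = 4 · 4q(4 + a)
-- (so growth applies), balls of radius T and J = T + a greedy rounds.
theorem5 : (k : ℕ) → 4 ≤ k →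
    (p q : ℕ) → 1 ≤ p → 1 ≤ q →
    ∃[ T ] ((t : ℕ) → 1 ≤ t → T ≤ t →
      (n : ℕ) (G : Graph n) → Connected G → MinDegreeAtLeast G k →
      GirthAtLeast G (2 * t + 1) →
      (m : ℕ) → IsOptimalPebblingNumber G m → m * q ≤ p * n)
theorem5 k 4≤k p q 1≤p 1≤q = T , bound
  where
  a s T : ℕ
  a = suc q
  s = 4 * q * (4 + a)
  T = 4 * s
  bound : (t : ℕ) → 1 ≤ t → T ≤ t →
          (n : ℕ) (G : Graph n) → Connected G → MinDegreeAtLeast G k →
          GirthAtLeast G (2 * t + 1) →
          (m : ℕ) → IsOptimalPebblingNumber G m → m * q ≤ p * n
  bound t _ T≤t n G _ minDegree girth m (_ , optimal)
    with Construction.sparse-solvable G (λ x → ≤-trans 4≤k (minDegree x))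
           t (Cycles.girth⇒noCycle G t girth) T T≤t (T + a)
  ... | D , solvable , l , w , size≡ , centres , leftovers = begin
    m * q                 ≤⟨ *-monoˡ-≤ q (optimal D solvable) ⟩
    size D * q            ≡⟨ cong (_* q) size≡ ⟩
    2 ^ T * (l + w) * q   ≤⟨ density {n} {q} {T} {a} {l} {w} (*-monoʳ-≤ 2 (<⇒≤ (n<2^n q)))
                               (growth (4 * q) a s (≤-trans 1≤q (m≤m+n q (3 * q))) refl)
                               centres leftovers ⟩
    n                     ≤⟨ m≤n*m n p {{>-nonZero 1≤p}} ⟩
    p * n                 ∎
    where open ≤-Reasoning
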